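{- Let $p$ be a prime with $p\equiv 1\pmod 4$ and $m\ge 1$ an integer. Then $\Gamma(\mathbb{Z}_{p^m})$ is Hamiltonian if and only if $m=2$.
   Context: For a finite commutative ring $R$ with unity, the zero-divisor graph $\Gamma(R)$ has vertex set the nonzero zero-divisors of $R$, with distinct $x,y$ adjacent iff $xy=0$. A graph of order $N$ is Hamiltonian if it contains a cycle of length $N$. -}

module Defs where

open import Data.Nat using (ℕ; _*_; _≤_)
open import Data.Nat.Divisibility using (_∣_)
open import Data.Fin using (Fin; toℕ)
open import Data.List using (List; []; _∷_; _++_; [_]; length)
open import Data.List.Relation.Unary.All using (All)
open import Data.List.Relation.Unary.Unique.Propositional using (Unique)
open import Data.List.Membership.Propositional using (_∈_)
open import Data.Product using (_×_; ∃-syntax)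
open import Data.Unit using (⊤)
open import Data.Empty using (⊥)
open import Relation.Binary.PropositionalEquality using (_≡_; _≢_)

Chain : ∀ {A : Set} → (A → A → Set) → List A → Set
Chain E [] = ⊤
Chain E (x ∷ []) = ⊤
Chain E (x ∷ y ∷ xs) = E x y × Chain E (y ∷ xs)

ClosedChain : ∀ {A : Set} → (A → A → Set) → List A → Set
ClosedChain E [] = ⊥
ClosedChain E (x ∷ xs) = Chain E ((x ∷ xs) ++ [ x ])

IsHamiltonianCycle : ∀ {A : Set} → (A → Set) → (A → A → Set) → List A → Set
IsHamiltonianCycle V E c =
  Unique c × All V c × (∀ v → V v → v ∈ c) × 3 ≤ length c × ClosedChain E c

Hamiltonian : ∀ {A : Set} → (A → Set) → (A → A → Set) → Set
Hamiltonian V E = ∃[ c ] IsHamiltonianCycle V E c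

-- The ring ℤ_n, elements represented by Fin n (residues 0,…,n-1);
-- x·y = 0 in ℤ_n iff n ∣ x*y.

MulIsZero : (n : ℕ) → Fin n → Fin n → Set
MulIsZero n x y = n ∣ toℕ x * toℕ y

ZDVertex : (n : ℕ) → Fin n → Set
ZDVertex n x = toℕ x ≢ 0 × ∃[ y ] (toℕ y ≢ 0 × MulIsZero n x y)

ZDAdj : (n : ℕ) → Fin n → Fin n → Set
ZDAdj n x y = x ≢ y × MulIsZero n x y

ZDGraphHamiltonian : ℕ → Set
ZDGraphHamiltonian n = Hamiltonian (ZDVertex n) (ZDAdj n)

module Submission where

-- The vertices of Γ(ℤ_{p^m}) are precisely the nonzero multiples of p
-- (a residue prime to p is a unit).  Hence:
--   * m = 1: there are no vertices at all, so there is no cycle;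
--   * m = 2: any two multiples of p multiply to 0 modulo p², so Γ is the
--     complete graph on the p - 1 nonzero multiples of p, and listing
--     them in any order gives a Hamiltonian cycle as soon as p - 1 ≥ 3
--     (this is the only use of p ≡ 1 (mod 4), which gives p ≥ 5);
--   * m ≥ 3: a vertex divisible by p exactly once is adjacent only to
--     multiples of p^(m-1).  In a Hamiltonian cycle every vertex is followed
--     by a neighbour, so there are at least as many multiples of p^(m-1) on
--     the cycle (at most p - 1 of them) as vertices of p-valuation one
--     (at least p of them, e.g. (ip + 1)p for i < p): a contradiction.

open import Defs
open import Data.Nat using (ℕ; zero; suc; _+_; _*_; _∸_; _^_; _%_; _≤_; _<_; z≤n; s≤s; z<s; NonZero; nonTrivial⇒n>1)
open import Data.Nat.Properties
open import Data.Nat.Divisibility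
open import Data.Nat.Primality using (Prime; euclidsLemma; prime⇒nonZero; prime⇒nonTrivial; ¬prime[0]; ¬prime[1])
open import Data.Nat.Tactic.RingSolver using (solve-∀)
open import Data.Fin using (Fin; toℕ; fromℕ<)
open import Data.Fin.Properties using (toℕ-fromℕ<; toℕ-injective; toℕ<n)
open import Data.List using (List; []; _∷_; _++_; [_]; length; filter; map; applyUpTo; allFin)
open import Data.List.Properties using (length-map; length-applyUpTo)
open import Data.List.Relation.Unary.All as All using (All; []; _∷_)
open import Data.List.Relation.Unary.All.Properties using (all-filter)
open import Data.List.Relation.Unary.Any using (here; there)
open import Data.List.Relation.Unary.AllPairs using (_∷_)
open import Data.List.Relation.Unary.Unique.Propositional using (Unique)
open import Data.List.Relation.Unary.Unique.Propositional.Properties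
  using (filter⁺; map⁺; allFin⁺; applyUpTo⁺₁)
open import Data.List.Relation.Binary.Permutation.Propositional.Properties
  using (↭-length; ∈-resp-↭; shift; ++-comm; filter-↭)
open import Data.List.Membership.Propositional using (_∈_)
open import Data.List.Membership.Propositional.Properties
  using (∈-∃++; ∈-filter⁺; ∈-filter⁻; ∈-map⁺; ∈-map⁻; ∈-allFin; ∈-applyUpTo⁺; ∈-applyUpTo⁻)
open import Data.Product using (_×_; _,_; proj₁)
open import Data.Sum using (inj₁; inj₂)
open import Data.Unit using (tt)
open import Data.Empty using (⊥-elim)
open import Function.Bundles using (_⇔_; mk⇔)
open import Relation.Nullary using (¬_; yes; no; contradiction)
open import Relation.Nullary.Decidable using (_×-dec_; ¬?)
open import Relation.Unary using (Decidable)
open import Relation.Binary.PropositionalEquality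
  using (_≡_; _≢_; refl; sym; trans; cong; subst; ≢-sym)

module _ {A : Set} where

  unique-⊆⇒length≤ : ∀ (xs ys : List A) → Unique xs →
                      (∀ {z} → z ∈ xs → z ∈ ys) → length xs ≤ length ys
  unique-⊆⇒length≤ []       ys _            _   = z≤n
  unique-⊆⇒length≤ (x ∷ xs) ys (x∉xs ∷ uniq) xs⊆ys with ∈-∃++ (xs⊆ys (here refl))
  ... | ys₁ , ys₂ , refl = begin
    suc (length xs)           ≤⟨ s≤s (unique-⊆⇒length≤ xs (ys₁ ++ ys₂) uniq xs⊆rest) ⟩
    suc (length (ys₁ ++ ys₂)) ≡⟨ ↭-length (shift x ys₁ ys₂) ⟨
    length (ys₁ ++ x ∷ ys₂)   ∎
    where
    open ≤-Reasoning
    xs⊆rest : ∀ {z} → z ∈ xs → z ∈ ys₁ ++ ys₂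
    xs⊆rest z∈xs with ∈-resp-↭ (shift x ys₁ ys₂) (xs⊆ys (there z∈xs))
    ... | here z≡x   = contradiction (sym z≡x) (All.lookup x∉xs z∈xs)
    ... | there z∈ys = z∈ys

  count : {P : A → Set} → Decidable P → List A → ℕ
  count P? xs = length (filter P? xs)

  module _ {E : A → A → Set} {P Q : A → Set} (P? : Decidable P) (Q? : Decidable Q)
           (P⇒Q : ∀ {a b} → E a b → P a → Q b) where

    walk-count : ∀ y zs w → Chain E (y ∷ zs ++ [ w ]) →
                 count P? (y ∷ zs) ≤ count Q? (zs ++ [ w ])
    walk-count y [] w (y~w , _) with P? y | Q? w
    ... | yes Py | yes _  = s≤s z≤n
    ... | yes Py | no ¬Qw = contradiction (P⇒Q y~w Py) ¬Qw
    ... | no _   | _      = z≤n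
    walk-count y (z ∷ zs) w (y~z , walk) with walk-count z zs w walk | P? y | Q? z
    ... | ih | yes Py | yes _  = s≤s ih
    ... | ih | yes Py | no ¬Qz = contradiction (P⇒Q y~z Py) ¬Qz
    ... | ih | no _   | yes _  = m≤n⇒m≤1+n ih
    ... | ih | no _   | no _   = ih

    -- On a closed walk the same holds for the walk itself, since counting
    -- is invariant under rotation.
    closedChain-count : ∀ c → ClosedChain E c → count P? c ≤ count Q? c
    closedChain-count (x ∷ xs) walk = begin
      count P? (x ∷ xs)      ≤⟨ walk-count x xs x walk ⟩
      count Q? (xs ++ [ x ]) ≡⟨ ↭-length (filter-↭ Q? (++-comm xs [ x ])) ⟩
      count Q? (x ∷ xs)      ∎
      where open ≤-Reasoning

  module _ {V : A → Set} {E : A → A → Set}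
           (adjacent : ∀ {a b} → V a → V b → a ≢ b → E a b) where

    complete-walk : ∀ xs {w} → Unique xs → All V xs → All (_≢ w) xs → V w →
                    Chain E (xs ++ [ w ])
    complete-walk []           _                _          _            _  = tt
    complete-walk (x ∷ [])     _                (Vx ∷ [])  (x≢w ∷ [])   Vw = adjacent Vx Vw x≢w , tt
    complete-walk (x ∷ y ∷ xs) ((x≢y ∷ _) ∷ uniq) (Vx ∷ Vs) (_ ∷ xs≢w) Vw =
      adjacent Vx (All.head Vs) x≢y , complete-walk (y ∷ xs) uniq Vs xs≢w Vw

    complete⇒closedChain : ∀ c → Unique c → All V c → 2 ≤ length c → ClosedChain E c
    complete⇒closedChain (x ∷ y ∷ ys) (x∉ ∷ uniq) (Vx ∷ Vs) _ =
      adjacent Vx (All.head Vs) (All.head x∉) ,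
      complete-walk (y ∷ ys) uniq Vs (All.map ≢-sym x∉) Vx
    complete⇒closedChain (_ ∷ []) _ _ (s≤s ())

module _ {n : ℕ} where

  enumeration≤length : ∀ {R : ℕ → Set} (c : List (Fin n)) → (∀ x → R (toℕ x) → x ∈ c) →
                       ∀ g k → (∀ {i j} → i < j → j < k → g i ≢ g j) →
                       (∀ {i} → i < k → g i < n × R (g i)) → k ≤ length c
  enumeration≤length {R} c contains g k distinct valid = begin
    k                      ≡⟨ length-applyUpTo g k ⟨
    length (applyUpTo g k) ≤⟨ unique-⊆⇒length≤ _ _ (applyUpTo⁺₁ g k distinct) listed ⟩
    length (map toℕ c)     ≡⟨ length-map toℕ c ⟩
    length c               ∎
    where
    open ≤-Reasoning
    listed : ∀ {a} → a ∈ applyUpTo g k → a ∈ map toℕ c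
    listed a∈ with ∈-applyUpTo⁻ g a∈
    ... | i , i<k , refl with valid i<k
    ... | gi<n , Rgi = subst (_∈ map toℕ c) (toℕ-fromℕ< gi<n)
      (∈-map⁺ toℕ (contains _ (subst R (sym (toℕ-fromℕ< gi<n)) Rgi)))

nonzero-multiples≤ : ∀ d q (xs : List (Fin (d * q))) → Unique xs →
                     (∀ {x} → x ∈ xs → toℕ x ≢ 0 × q ∣ toℕ x) → length xs ≤ d ∸ 1
nonzero-multiples≤ d q xs uniq multiples = begin
  length xs                  ≡⟨ length-map toℕ xs ⟨
  length (map toℕ xs)        ≤⟨ unique-⊆⇒length≤ _ _ (map⁺ toℕ-injective uniq) listed ⟩
  length (applyUpTo qth (d ∸ 1)) ≡⟨ length-applyUpTo qth (d ∸ 1) ⟩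
  d ∸ 1                      ∎
  where
  open ≤-Reasoning
  qth : ℕ → ℕ
  qth j = suc j * q
  listed : ∀ {a} → a ∈ map toℕ xs → a ∈ applyUpTo qth (d ∸ 1)
  listed a∈ with ∈-map⁻ toℕ a∈
  ... | x , x∈xs , refl with multiples x∈xs
  ... | x≢0 , divides zero    x≡0    = contradiction x≡0 x≢0
  ... | _   , divides (suc j) x≡jq = subst (_∈ applyUpTo qth (d ∸ 1)) (sym x≡jq)
    (∈-applyUpTo⁺ qth (pred-bound (*-cancelʳ-< q (suc j) d (subst (_< d * q) x≡jq (toℕ<n x)))))
    where
    pred-bound : ∀ {i e} → suc i < e → i < e ∸ 1
    pred-bound {e = suc e} (s≤s i<e) = i<e

multiple<⇒≡0 : ∀ {d x} → d ∣ x → x < d → x ≡ 0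
multiple<⇒≡0 {x = zero}  _   _   = refl
multiple<⇒≡0 {x = suc _} d∣x x<d = contradiction d∣x (>⇒∤ x<d)

p%4≡1⇒5≤p : ∀ {p} → Prime p → p % 4 ≡ 1 → 5 ≤ p
p%4≡1⇒5≤p {0} isPrime _ = contradiction isPrime ¬prime[0]
p%4≡1⇒5≤p {1} isPrime _ = contradiction isPrime ¬prime[1]
p%4≡1⇒5≤p {suc (suc (suc (suc (suc _))))} _ _ = s≤s (s≤s (s≤s (s≤s (s≤s z≤n))))

module _ {p : ℕ} (isPrime : Prime p) where

  private instance
    p≢0 : NonZero p
    p≢0 = prime⇒nonZero isPrime

  1<p : 1 < p
  1<p = nonTrivial⇒n>1 p {{prime⇒nonTrivial isPrime}}

  prime^∣*⇒∣ : ∀ j {k y} → ¬ p ∣ k → p ^ j ∣ k * y → p ^ j ∣ y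
  prime^∣*⇒∣ zero    {y = y} _ _ = 1∣ y
  prime^∣*⇒∣ (suc j) {k} {y} p∤k p^j+1∣ky with euclidsLemma k y isPrime (∣-trans (m∣m*n (p ^ j)) p^j+1∣ky)
  ... | inj₁ p∣k = contradiction p∣k p∤k
  ... | inj₂ (divides y′ refl) =
    subst (p * p ^ j ∣_) (*-comm p y′) (*-monoʳ-∣ p (prime^∣*⇒∣ j p∤k p^j∣ky′))
    where
    reassociate : ∀ a b c → a * (b * c) ≡ c * (a * b)
    reassociate = solve-∀
    p^j∣ky′ : p ^ j ∣ k * y′
    p^j∣ky′ = *-cancelˡ-∣ p (subst (p * p ^ j ∣_) (reassociate k y′ p) p^j+1∣ky)

  exactly-once-annihilator : ∀ k {x y} → p ∣ x → ¬ p * p ∣ x → p ^ suc k ∣ x * y → p ^ k ∣ y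
  exactly-once-annihilator k {y = y} (divides j refl) p²∤x p^k+1∣xy =
    prime^∣*⇒∣ k p∤j (*-cancelˡ-∣ p (subst (p ^ suc k ∣_) (reassociate j p y) p^k+1∣xy))
    where
    reassociate : ∀ a b c → a * b * c ≡ b * (a * c)
    reassociate = solve-∀
    p∤j : ¬ p ∣ j
    p∤j p∣j = p²∤x (*-monoˡ-∣ p p∣j)

  -- A nonzero zero-divisor of ℤ_{p^m} is a multiple of p: a residue prime
  -- to p only annihilates 0.
  vertex⇒p∣ : ∀ m (x : Fin (p ^ m)) → ZDVertex (p ^ m) x → p ∣ toℕ x
  vertex⇒p∣ m x (_ , y , y≢0 , xy≡0) with p ∣? toℕ x
  ... | yes p∣x = p∣x
  ... | no  p∤x = contradiction (multiple<⇒≡0 (prime^∣*⇒∣ m p∤x xy≡0) (toℕ<n y)) y≢0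

  -- Conversely every nonzero multiple of p is a vertex of Γ(ℤ_{p^(k+1)}):
  -- it is annihilated by p^k.
  p∣⇒vertex : ∀ k (x : Fin (p ^ suc k)) → p ∣ toℕ x → toℕ x ≢ 0 → ZDVertex (p ^ suc k) x
  p∣⇒vertex k x p∣x x≢0 = x≢0 , p^k , p^k≢0 , subst (λ a → p ^ suc k ∣ toℕ x * a) (sym value) p^k+1∣xp^k
    where
    p^k<p^k+1 : p ^ k < p ^ suc k
    p^k<p^k+1 = subst (_< p * p ^ k) (*-identityˡ (p ^ k))
                      (*-monoˡ-< (p ^ k) {{m^n≢0 p k}} 1<p)
    p^k : Fin (p ^ suc k)
    p^k = fromℕ< p^k<p^k+1
    value : toℕ p^k ≡ p ^ k
    value = toℕ-fromℕ< p^k<p^k+1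
    p^k≢0 : toℕ p^k ≢ 0
    p^k≢0 p^k≡0 = >⇒≢ (m^n>0 p k) (trans (sym value) p^k≡0)
    p^k+1∣xp^k : p ^ suc k ∣ toℕ x * p ^ k
    p^k+1∣xp^k = *-pres-∣ p∣x ∣-refl

  -- m = 1: ℤ_p is a field, so Γ(ℤ_p) has no vertices and hence no cycle.
  ¬hamiltonian[p¹] : ¬ ZDGraphHamiltonian (p ^ 1)
  ¬hamiltonian[p¹] ([]    , _ , _       , _ , () , _)
  ¬hamiltonian[p¹] (x ∷ _ , _ , Vx ∷ _ , _) = proj₁ Vx (multiple<⇒≡0 (vertex⇒p∣ 1 x Vx) x<p)
    where
    x<p : toℕ x < p
    x<p = subst (toℕ x <_) (*-identityʳ p) (toℕ<n x)

  -- Values that are nonzero multiples of p: by vertex⇒p∣ and p∣⇒vertex these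
  -- are exactly the vertices of Γ(ℤ_{p^(k+1)}).
  NonzeroMultiple : ℕ → Set
  NonzeroMultiple a = p ∣ a × a ≢ 0

  nonzeroMultiple? : Decidable NonzeroMultiple
  nonzeroMultiple? a = (p ∣? a) ×-dec ¬? (a ≟ 0)

  -- Any two multiples of p multiply to 0 modulo p², so Γ(ℤ_{p²}) is complete
  -- on its p - 1 vertices; listing them is a Hamiltonian cycle once there are
  -- at least three of them (p, 2p, 3p), i.e. once p > 3.
  hamiltonian[p²] : 3 < p → ZDGraphHamiltonian (p ^ 2)
  hamiltonian[p²] 3<p = cycle , unique , vertices , cover , 3≤length ,
                        complete⇒closedChain adjacent cycle unique vertices (≤-trans (s≤s (s≤s z≤n)) 3≤length)
    where
    p²≡p*p : p ^ 2 ≡ p * p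
    p²≡p*p = cong (p *_) (*-identityʳ p)

    cycle : List (Fin (p ^ 2))
    cycle = filter (λ x → nonzeroMultiple? (toℕ x)) (allFin _)

    unique : Unique cycle
    unique = filter⁺ _ (allFin⁺ _)

    vertices : All (ZDVertex (p ^ 2)) cycle
    vertices = All.map (λ {x} (p∣x , x≢0) → p∣⇒vertex 1 x p∣x x≢0) (all-filter _ (allFin _))

    contains : ∀ x → NonzeroMultiple (toℕ x) → x ∈ cycle
    contains x = ∈-filter⁺ _ (∈-allFin x)

    cover : ∀ x → ZDVertex (p ^ 2) x → x ∈ cycle
    cover x Vx = contains x (vertex⇒p∣ 2 x Vx , proj₁ Vx)

    3≤length : 3 ≤ length cycle
    3≤length = enumeration≤length {R = NonzeroMultiple} cycle contains (λ i → suc i * p) 3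
      (λ i<j _ eq → <⇒≢ i<j (suc-injective (*-cancelʳ-≡ _ _ p eq)))
      (λ {i} i<3 → subst (suc i * p <_) (sym p²≡p*p) (*-monoˡ-< p (≤-<-trans i<3 3<p)) ,
                   n∣m*n (suc i) , >⇒≢ (*-monoˡ-< p {0} {suc i} z<s))

    adjacent : ∀ {a b} → ZDVertex (p ^ 2) a → ZDVertex (p ^ 2) b → a ≢ b → ZDAdj (p ^ 2) a b
    adjacent {a} {b} Va Vb a≢b = a≢b ,
      subst (_∣ toℕ a * toℕ b) (sym p²≡p*p) (*-pres-∣ (vertex⇒p∣ 2 a Va) (vertex⇒p∣ 2 b Vb))

  ExactlyOnce : ℕ → Set
  ExactlyOnce a = p ∣ a × ¬ p * p ∣ a

  exactlyOnce? : Decidable ExactlyOnce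
  exactlyOnce? a = (p ∣? a) ×-dec ¬? (p * p ∣? a)

  exactlyOnce⇒≢0 : ∀ {a} → ExactlyOnce a → a ≢ 0
  exactlyOnce⇒≢0 (_ , p²∤a) refl = p²∤a ((p * p) ∣0)

  -- The p values (ip + 1)p, i < p, are divisible by p exactly once and lie
  -- below p³ ≤ p^(k+3); they witness that there are at least p such vertices.
  once-family : ℕ → ℕ
  once-family i = (i * p + 1) * p

  once-family-injective : ∀ {i j} → once-family i ≡ once-family j → i ≡ j
  once-family-injective {i} {j} eq =
    *-cancelʳ-≡ i j p (+-cancelʳ-≡ 1 (i * p) (j * p) (*-cancelʳ-≡ _ _ p eq))

  once-family-once : ∀ i → ExactlyOnce (once-family i)
  once-family-once i = n∣m*n (i * p + 1) , p²∤
    where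
    p∤ip+1 : ¬ p ∣ i * p + 1
    p∤ip+1 p∣ip+1 = <⇒≢ 1<p (sym (∣1⇒≡1 (∣m+n∣m⇒∣n p∣ip+1 (n∣m*n i))))
    p²∤ : ¬ p * p ∣ once-family i
    p²∤ p²∣ = p∤ip+1 (*-cancelʳ-∣ p p²∣)

  once-family-< : ∀ k {i} → i < p → once-family i < p ^ (3 + k)
  once-family-< k {i} i<p = begin-strict
    (i * p + 1) * p   <⟨ *-monoˡ-< p ip+1<q ⟩
    q * p             ≡⟨ *-comm q p ⟩
    p * q             ∎
    where
    open ≤-Reasoning
    q : ℕ
    q = p ^ (2 + k)
    ip+1<q : i * p + 1 < q
    ip+1<q = begin-strict
      i * p + 1       <⟨ +-monoʳ-< (i * p) 1<p ⟩
      i * p + p       ≡⟨ +-comm (i * p) p ⟩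
      suc i * p       ≤⟨ *-monoˡ-≤ p i<p ⟩
      p * p           ≤⟨ *-monoʳ-≤ p (m≤m*n p (p ^ k) {{m^n≢0 p k}}) ⟩
      q               ∎

  -- In Γ(ℤ_{p^(k+3)}) a vertex divisible by p exactly once is adjacent only to
  -- multiples of q = p^(k+2), of which there are at most p - 1, while there
  -- are at least p vertices divisible by p exactly once.  Since in a
  -- Hamiltonian cycle every vertex is followed by a neighbour, this is
  -- impossible.
  ¬hamiltonian[p³⁺ᵏ] : ∀ k → ¬ ZDGraphHamiltonian (p ^ (3 + k))
  ¬hamiltonian[p³⁺ᵏ] k (c , unique , vertices , cover , _ , closed) = p≰p∸1 (begin
    p                 ≤⟨ at-least-p-once ⟩
    count once? c     ≤⟨ closedChain-count once? multiple? neighbour c closed ⟩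
    count multiple? c ≤⟨ at-most-p∸1-multiples ⟩
    p ∸ 1             ∎)
    where
    open ≤-Reasoning
    q : ℕ
    q = p ^ (2 + k)

    once? : Decidable (λ (x : Fin (p ^ (3 + k))) → ExactlyOnce (toℕ x))
    once? x = exactlyOnce? (toℕ x)

    multiple? : Decidable (λ (x : Fin (p ^ (3 + k))) → q ∣ toℕ x)
    multiple? x = q ∣? toℕ x

    contains : ∀ x → ExactlyOnce (toℕ x) → x ∈ filter once? c
    contains x once = ∈-filter⁺ once? (cover x (p∣⇒vertex (2 + k) x (proj₁ once) (exactlyOnce⇒≢0 once))) once

    neighbour : ∀ {a b} → ZDAdj (p ^ (3 + k)) a b → ExactlyOnce (toℕ a) → q ∣ toℕ b
    neighbour (_ , ab≡0) (p∣a , p²∤a) = exactly-once-annihilator (2 + k) p∣a p²∤a ab≡0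

    nonzero-multiple : ∀ {x} → x ∈ filter multiple? c → toℕ x ≢ 0 × q ∣ toℕ x
    nonzero-multiple x∈ with ∈-filter⁻ multiple? x∈
    ... | x∈c , q∣x = proj₁ (All.lookup vertices x∈c) , q∣x

    at-least-p-once : p ≤ count once? c
    at-least-p-once = enumeration≤length {R = ExactlyOnce} (filter once? c) contains once-family p
      (λ i<j _ eq → <⇒≢ i<j (once-family-injective eq))
      (λ {i} i<p → once-family-< k i<p , once-family-once i)

    at-most-p∸1-multiples : count multiple? c ≤ p ∸ 1
    at-most-p∸1-multiples =
      nonzero-multiples≤ p q (filter multiple? c) (filter⁺ multiple? unique) nonzero-multiple

    p≰p∸1 : ¬ p ≤ p ∸ 1
    p≰p∸1 = <⇒≱ (∸-monoʳ-< {p} {1} {0} z<s (<⇒≤ 1<p))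

lemma2p6 : (p m : ℕ) → Prime p → p % 4 ≡ 1 → 1 ≤ m →
             ZDGraphHamiltonian (p ^ m) ⇔ (m ≡ 2)
lemma2p6 p m isPrime p≡1[4] 1≤m = mk⇔ (only-m≡2 m 1≤m) m≡2⇒hamiltonian
  where
  only-m≡2 : ∀ e → 1 ≤ e → ZDGraphHamiltonian (p ^ e) → e ≡ 2
  only-m≡2 0                   ()
  only-m≡2 1                   _ ham = ⊥-elim (¬hamiltonian[p¹] isPrime ham)
  only-m≡2 2                   _ _   = refl
  only-m≡2 (suc (suc (suc k))) _ ham = ⊥-elim (¬hamiltonian[p³⁺ᵏ] isPrime k ham)

  m≡2⇒hamiltonian : m ≡ 2 → ZDGraphHamiltonian (p ^ m)
  m≡2⇒hamiltonian refl = hamiltonian[p²] isPrime (<⇒≤ (p%4≡1⇒5≤p isPrime p≡1[4]))
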